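{- Let $k\ge 3$, let $F$ be a $k$-edge graph with $\gamma(F)=1$, let $G$ be a pure $(m,F)$-special graph, let $H$ and $I$ be distinct $F$-constituents of $G$, and let $x\in V(H)$ and $y\in V(I)$. Then $G$ has a minimum $F$-isolating set $D$ with $x,y\in D$.
   Context: All graphs are finite and simple. A copy of $F$ in a graph is a subgraph isomorphic to $F$. $N[D]$ denotes the closed neighbourhood of a vertex set $D$. A set $D\subseteq V(G)$ is an $F$-isolating set of $G$ if $G-N[D]$ contains no copy of $F$; it is minimum if of smallest size. $\gamma(F)=1$ means $F$ has a vertex adjacent to all other vertices of $F$. Pure $(m,F)$-special graph: for an integer $q\ge 1$ with $m+1=q(k+2)$, take distinct vertices $v_1,\dots,v_q$, copies $F_1,\dots,F_q$ of $F$ whose vertex sets are pairwise disjoint and disjoint from $\{v_1,\dots,v_q\}$, vertices $w_i\in V(F_i)$, and a tree $T$ with vertex set $\{v_1,\dots,v_q\}$ (the quotient graph). The graph with vertex set $\{v_1,\dots,v_q\}\cup\bigcup_i V(F_i)$ and edge set $E(T)\cup\bigcup_i (E(F_i)\cup\{v_iw_i\})$ is a pure $(m,F)$-special graph; the subgraphs $G_i$ with vertex set $\{v_i\}\cup V(F_i)$ and edge set $E(F_i)\cup\{v_iw_i\}$ are its $F$-constituents. -}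

module Defs where

open import Data.Nat using (ℕ; zero; suc; _+_; _*_; _≤_; _<ᵇ_)
open import Data.Fin using (Fin; toℕ; _≟_)
open import Data.Bool using (Bool; true; false; T; _∧_; if_then_else_)
open import Data.List using (List; []; _∷_; _++_; length; map; allFin)
open import Data.Nat.ListAction using (sum)
open import Data.List.Membership.Propositional using (_∈_)
open import Data.List.Relation.Unary.Unique.Propositional using (Unique)
open import Data.List.Relation.Unary.Linked using (Linked)
open import Data.Product using (Σ; ∃; ∃-syntax; _×_; _,_)
open import Data.Sum using (_⊎_; inj₁; inj₂)
open import Relation.Nullary using (¬_; yes; no)
open import Relation.Nullary.Decidable using (⌊_⌋)
open import Relation.Binary.PropositionalEquality using (_≡_; _≢_; refl)
open import Function.Bundles using (_↔_; Inverse)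
open import Function.Definitions using (Injective)

Adjacency : Set → Set
Adjacency V = V → V → Bool

record IsSimple {V : Set} (adj : Adjacency V) : Set where
  field
    symmetric   : ∀ u v → adj u v ≡ adj v u
    irreflexive : ∀ u → adj u u ≡ false

_~[_]_ : {V : Set} → V → Adjacency V → V → Set
u ~[ adj ] v = T (adj u v)

edgeCount : ∀ {p} → Adjacency (Fin p) → ℕ
edgeCount {p} adj =
  sum (map (λ i → sum (map (λ j → if (toℕ i <ᵇ toℕ j) ∧ adj i j then 1 else 0)
                           (allFin p)))
           (allFin p))

-- γ(F) = 1 : some vertex adjacent to all other vertices
HasDominatingVertex : {V : Set} → Adjacency V → Set
HasDominatingVertex {V} adj = Σ V λ c → ∀ u → u ≢ c → c ~[ adj ] u

_≅_ : {A B : Set} → Adjacency A → Adjacency B → Set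
_≅_ {A} {B} adjA adjB =
  Σ (A ↔ B) λ f → ∀ u v → adjA u v ≡ adjB (Inverse.to f u) (Inverse.to f v)

data Walk {V : Set} (adj : Adjacency V) : V → V → Set where
  []  : ∀ {u} → Walk adj u u
  _∷_ : ∀ {u v w} → u ~[ adj ] v → Walk adj v w → Walk adj u w

Connected : {V : Set} → Adjacency V → Set
Connected {V} adj = ∀ (u v : V) → Walk adj u v

Cycle : {V : Set} → Adjacency V → Set
Cycle {V} adj =
  Σ V λ x → Σ V λ y → Σ (List V) λ mid →
    let xs = x ∷ (mid ++ (y ∷ [])) in
    1 ≤ length mid × Unique xs × Linked (λ a b → a ~[ adj ] b) xs × y ~[ adj ] x

Acyclic : {V : Set} → Adjacency V → Set
Acyclic adj = ¬ Cycle adj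

IsTree : {V : Set} → Adjacency V → Set
IsTree adj = IsSimple adj × Connected adj × Acyclic adj

-- F-isolating sets (vertex sets are duplicate-free lists)

InClosedNbhd : {V : Set} → Adjacency V → List V → V → Set
InClosedNbhd adj D u = ∃[ d ] (d ∈ D × (u ≡ d ⊎ u ~[ adj ] d))

CopyAvoiding : ∀ {p} {V : Set} → Adjacency (Fin p) → Adjacency V → List V → Set
CopyAvoiding {p} {V} adjF adjG D =
  Σ (Fin p → V) λ f →
    Injective _≡_ _≡_ f ×
    (∀ a b → a ~[ adjF ] b → f a ~[ adjG ] f b) ×
    (∀ a → ¬ InClosedNbhd adjG D (f a))

IsIsolating : ∀ {p} {V : Set} → Adjacency (Fin p) → Adjacency V → List V → Set
IsIsolating adjF adjG D = ¬ CopyAvoiding adjF adjG D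

IsMinIsolating : ∀ {p} {V : Set} → Adjacency (Fin p) → Adjacency V → List V → Set
IsMinIsolating {p} {V} adjF adjG D =
  Unique D × IsIsolating adjF adjG D ×
  (∀ (D' : List V) → Unique D' → IsIsolating adjF adjG D' → length D ≤ length D')

-- Pure (m,F)-special graphs.
-- Vertices: inj₁ i is v_i ; inj₂ (i , a) is vertex a of the copy F_i.

SVert : ℕ → ℕ → Set
SVert q p = Fin q ⊎ (Fin q × Fin p)

copyAdj : ∀ {q p} → (Fin q → Adjacency (Fin p)) →
          Fin q → Fin p → Fin q → Fin p → Bool
copyAdj Fs i a j b with i ≟ j
... | yes refl = Fs i a b
... | no _     = false

specialAdj : ∀ {q p} → Adjacency (Fin q) → (Fin q → Adjacency (Fin p)) →
             (Fin q → Fin p) → Adjacency (SVert q p)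
specialAdj T Fs w (inj₁ i)       (inj₁ j)       = T i j
specialAdj T Fs w (inj₁ i)       (inj₂ (j , b)) = ⌊ i ≟ j ⌋ ∧ ⌊ b ≟ w j ⌋
specialAdj T Fs w (inj₂ (i , a)) (inj₁ j)       = ⌊ i ≟ j ⌋ ∧ ⌊ a ≟ w i ⌋
specialAdj T Fs w (inj₂ (i , a)) (inj₂ (j , b)) = copyAdj Fs i a j b

InConstituent : ∀ {q p} → Fin q → SVert q p → Set
InConstituent i (inj₁ j)       = j ≡ i
InConstituent i (inj₂ (j , _)) = j ≡ i

-- Take D to consist of x, y and the hub v_l of every other constituent G_l.  An
-- F-isolating set must meet every constituent G_l, since otherwise the copy F_l
-- survives; as D has one vertex per constituent, it is minimum.  Suppose a copy of F
-- avoids N[D] and its dominating vertex c sits at z.  If z lies in some F_l, the whole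
-- copy lies in G_l, which has p + 1 vertices, two of which (the D-vertex of G_l and a
-- neighbour of it) are excluded.  If z = v_l with l ∉ {i, j}, then z ∈ D.  If z = v_i,
-- every other vertex of the copy is v_j or w_i, which are not adjacent, whereas F − c
-- has three vertices or an edge because F has at least three edges.

module Submission where

open import Defs
open import Data.Nat using (ℕ; suc; _+_; _*_; _≤_; s≤s)
open import Data.Nat.Properties using (1+n≰n)
open import Data.Fin using (Fin; zero; suc; _≟_; punchOut)
open import Data.Fin.Properties using (suc-injective; punchOut-injective; injective⇒≤)
open import Data.Bool using (true; false; T; if_then_else_)
open import Data.Bool.Properties using (T-∧)
open import Data.Unit using (tt)
open import Data.Empty using (⊥; ⊥-elim)
open import Data.List using (List; map; allFin; length; lookup)
open import Data.List.Properties using (length-map; length-tabulate)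
open import Data.List.Membership.Propositional using (_∈_; lose)
open import Data.List.Membership.Propositional.Properties using (∈-map⁺; ∈-allFin)
open import Data.List.Relation.Unary.Any using (Any; any?; index)
open import Data.List.Relation.Unary.Any.Properties using (lookup-index)
open import Data.List.Relation.Unary.Unique.Propositional using (Unique)
open import Data.List.Relation.Unary.Unique.Propositional.Properties using (map⁺; allFin⁺)
open import Data.Product using (Σ; _×_; _,_; proj₁; proj₂; ∃-syntax)
open import Data.Sum using (_⊎_; inj₁; inj₂)
open import Function using (_∘_; Equivalence)
open import Function.Bundles using (Inverse)
open import Function.Definitions using (Injective)
open import Relation.Nullary using (¬_; yes; no; Dec)
open import Relation.Nullary.Decidable using (toWitness; fromWitness)
open import Relation.Binary.PropositionalEquality
  using (_≡_; _≢_; refl; sym; trans; cong; cong₂; subst; subst₂)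

¬T-false : ∀ {b} → b ≡ false → ¬ T b
¬T-false refl ()

punchOut∘ : ∀ {m n} {e : Fin (suc n)} (h : Fin m → Fin (suc n)) →
            (∀ a → e ≢ h a) → Fin m → Fin n
punchOut∘ h miss a = punchOut (miss a)

punchOut∘-injective : ∀ {m n} {e : Fin (suc n)} {h : Fin m → Fin (suc n)}
                      (miss : ∀ a → e ≢ h a) →
                      Injective _≡_ _≡_ h → Injective _≡_ _≡_ (punchOut∘ h miss)
punchOut∘-injective miss h-inj eq = h-inj (punchOut-injective (miss _) (miss _) eq)

injection-missing-two⇒empty : ∀ {n} {h : Fin n → Fin (suc n)} {e₁ e₂} →
  Injective _≡_ _≡_ h → e₁ ≢ e₂ → (∀ a → e₁ ≢ h a) → (∀ a → e₂ ≢ h a) → ¬ Fin n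
injection-missing-two⇒empty {suc n} {h} {e₁} {e₂} h-inj e₁≢e₂ miss₁ miss₂ _ =
  1+n≰n (injective⇒≤ (punchOut∘-injective miss₂′ (punchOut∘-injective miss₁ h-inj)))
  where
    miss₂′ : ∀ a → punchOut e₁≢e₂ ≢ punchOut∘ h miss₁ a
    miss₂′ a = miss₂ a ∘ punchOut-injective e₁≢e₂ (miss₁ a)

NoIsolatedVertex : {V : Set} → Adjacency V → Set
NoIsolatedVertex {V} adj = ∀ (v : V) → ∃[ u ] u ~[ adj ] v

dominating⇒noIsolatedVertex : ∀ {p} {F : Adjacency (Fin p)} {c a} → IsSimple F →
  (∀ u → u ≢ c → c ~[ F ] u) → a ≢ c → NoIsolatedVertex F
dominating⇒noIsolatedVertex {c = c} {a} F-simple c-dom a≢c v with v ≟ c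
... | yes refl = a , subst T (IsSimple.symmetric F-simple c a) (c-dom a a≢c)
... | no v≢c   = c , c-dom v v≢c

module _ {A B : Set} {adjA : Adjacency A} {adjB : Adjacency B} (iso : adjA ≅ adjB) where
  open Inverse (proj₁ iso)

  ≅-from-edge : ∀ {u v} → u ~[ adjB ] v → from u ~[ adjA ] from v
  ≅-from-edge {u} {v} =
    subst T (sym (trans (proj₂ iso (from u) (from v))
                        (cong₂ adjB (strictlyInverseˡ u) (strictlyInverseˡ v))))

  ≅-from-injective : Injective _≡_ _≡_ from
  ≅-from-injective {u} {v} eq =
    trans (sym (strictlyInverseˡ u)) (trans (cong to eq) (strictlyInverseˡ v))

  ≅-irreflexive : (∀ v → adjB v v ≡ false) → ∀ u → adjA u u ≡ false
  ≅-irreflexive irr u = trans (proj₂ iso u u) (irr (to u))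

  ≅-noIsolatedVertex : NoIsolatedVertex adjB → NoIsolatedVertex adjA
  ≅-noIsolatedVertex noIso a with noIso (to a)
  ... | s , s~a = from s , subst (λ z → from s ~[ adjA ] z) (strictlyInverseʳ a) (≅-from-edge s~a)

data OutgrowsIndependentPair {p} (F : Adjacency (Fin p)) (c : Fin p) : Set where
  three-others  : ∀ a b d → a ≢ c → b ≢ c → d ≢ c → a ≢ b → a ≢ d → b ≢ d →
                  OutgrowsIndependentPair F c
  edge-avoiding : ∀ a b → a ≢ c → b ≢ c → a ≢ b → a ~[ F ] b →
                  OutgrowsIndependentPair F c

outgrows⇒other : ∀ {p} {F : Adjacency (Fin p)} {c} → OutgrowsIndependentPair F c →
                 ∃[ a ] a ≢ c
outgrows⇒other (three-others a _ _ a≢c _ _ _ _ _) = a , a≢c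
outgrows⇒other (edge-avoiding a _ a≢c _ _ _)      = a , a≢c

-- The left-hand sides are edgeCount on two and on three vertices, in normal form.
edgeCount₂≱3 : ∀ b → ¬ 3 ≤ (if b then 1 else 0) + 0 + 0
edgeCount₂≱3 true  (s≤s ())
edgeCount₂≱3 false ()

edgeCount₃≥3⇒triangle : ∀ b₀₁ b₀₂ b₁₂ →
  3 ≤ (if b₀₁ then 1 else 0) + ((if b₀₂ then 1 else 0) + 0) + ((if b₁₂ then 1 else 0) + 0 + 0) →
  T b₀₁ × T b₀₂ × T b₁₂
edgeCount₃≥3⇒triangle true  true  true  _                 = tt , tt , tt
edgeCount₃≥3⇒triangle true  true  false (s≤s (s≤s ()))
edgeCount₃≥3⇒triangle true  false true  (s≤s (s≤s ()))
edgeCount₃≥3⇒triangle false true  true  (s≤s (s≤s ()))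
edgeCount₃≥3⇒triangle true  false false (s≤s ())
edgeCount₃≥3⇒triangle false true  false (s≤s ())
edgeCount₃≥3⇒triangle false false true  (s≤s ())
edgeCount₃≥3⇒triangle false false false ()

outgrowsIndependentPair : ∀ {p} (F : Adjacency (Fin p)) → 3 ≤ edgeCount F →
                          ∀ c → OutgrowsIndependentPair F c
outgrowsIndependentPair {1} F () c
outgrowsIndependentPair {2} F 3≤e c = ⊥-elim (edgeCount₂≱3 _ 3≤e)
outgrowsIndependentPair {3} F 3≤e c = pick c (edgeCount₃≥3⇒triangle _ _ _ 3≤e)
  where
    pick : ∀ c → T (F zero (suc zero)) × T (F zero (suc (suc zero))) ×
                 T (F (suc zero) (suc (suc zero))) → OutgrowsIndependentPair F c
    pick zero             (_ , _ , e₁₂) = edge-avoiding (suc zero) (suc (suc zero)) (λ ()) (λ ()) (λ ()) e₁₂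
    pick (suc zero)       (_ , e₀₂ , _) = edge-avoiding zero (suc (suc zero)) (λ ()) (λ ()) (λ ()) e₀₂
    pick (suc (suc zero)) (e₀₁ , _ , _) = edge-avoiding zero (suc zero) (λ ()) (λ ()) (λ ()) e₀₁
outgrowsIndependentPair {suc (suc (suc (suc _)))} F _ zero =
  three-others (suc zero) (suc (suc zero)) (suc (suc (suc zero)))
               (λ ()) (λ ()) (λ ()) (λ ()) (λ ()) (λ ())
outgrowsIndependentPair {suc (suc (suc (suc _)))} F _ (suc zero) =
  three-others zero (suc (suc zero)) (suc (suc (suc zero)))
               (λ ()) (λ ()) (λ ()) (λ ()) (λ ()) (λ ())
outgrowsIndependentPair {suc (suc (suc (suc _)))} F _ (suc (suc zero)) =
  three-others zero (suc zero) (suc (suc (suc zero)))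
               (λ ()) (λ ()) (λ ()) (λ ()) (λ ()) (λ ())
outgrowsIndependentPair {suc (suc (suc (suc _)))} F _ (suc (suc (suc _))) =
  three-others zero (suc zero) (suc (suc zero))
               (λ ()) (λ ()) (λ ()) (λ ()) (λ ()) (λ ())

no-copy-into-independent-pair :
  ∀ {p V} {F : Adjacency (Fin p)} {G : Adjacency V} {c} → OutgrowsIndependentPair F c →
  (f : Fin p → V) → Injective _≡_ _≡_ f → (∀ a b → a ~[ F ] b → f a ~[ G ] f b) →
  (P Q : V) → ¬ P ~[ G ] Q → ¬ Q ~[ G ] P → ¬ (∀ u → u ≢ c → f u ≡ P ⊎ f u ≡ Q)
no-copy-into-independent-pair {G = G} out f f-inj f-edge P Q P≁Q Q≁P into with out
... | three-others a b d a≢c b≢c d≢c a≢b a≢d b≢d =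
  collide (into a a≢c) (into b b≢c) (into d d≢c)
  where
    same : ∀ {u v z} → f u ≡ z → f v ≡ z → u ≡ v
    same fu fv = f-inj (trans fu (sym fv))
    collide : f a ≡ P ⊎ f a ≡ Q → f b ≡ P ⊎ f b ≡ Q → f d ≡ P ⊎ f d ≡ Q → ⊥
    collide (inj₁ fa) (inj₁ fb) _         = a≢b (same fa fb)
    collide (inj₂ fa) (inj₂ fb) _         = a≢b (same fa fb)
    collide (inj₁ fa) (inj₂ _)  (inj₁ fd) = a≢d (same fa fd)
    collide (inj₁ _)  (inj₂ fb) (inj₂ fd) = b≢d (same fb fd)
    collide (inj₂ _)  (inj₁ fb) (inj₁ fd) = b≢d (same fb fd)
    collide (inj₂ fa) (inj₁ _)  (inj₂ fd) = a≢d (same fa fd)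
... | edge-avoiding a b a≢c b≢c a≢b a~b = edge-between (into a a≢c) (into b b≢c)
  where
    edge-between : f a ≡ P ⊎ f a ≡ Q → f b ≡ P ⊎ f b ≡ Q → ⊥
    edge-between (inj₁ fa) (inj₁ fb) = a≢b (f-inj (trans fa (sym fb)))
    edge-between (inj₂ fa) (inj₂ fb) = a≢b (f-inj (trans fa (sym fb)))
    edge-between (inj₁ fa) (inj₂ fb) = P≁Q (subst₂ (λ u v → u ~[ G ] v) fa fb (f-edge a b a~b))
    edge-between (inj₂ fa) (inj₁ fb) = Q≁P (subst₂ (λ u v → u ~[ G ] v) fa fb (f-edge a b a~b))

constituent-unique : ∀ {q p} {l l′ : Fin q} (v : SVert q p) →
                     InConstituent l v → InConstituent l′ v → l ≡ l′
constituent-unique (inj₁ _)       refl refl = refl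
constituent-unique (inj₂ (_ , _)) refl refl = refl

inConstituent? : ∀ {q p} (l : Fin q) (v : SVert q p) → Dec (InConstituent l v)
inConstituent? l (inj₁ m)       = m ≟ l
inConstituent? l (inj₂ (m , _)) = m ≟ l

slot : ∀ {q p} → SVert q p → Fin (suc p)
slot (inj₁ _)       = zero
slot (inj₂ (_ , a)) = suc a

slot-injective : ∀ {q p} {l : Fin q} {u v : SVert q p} →
  InConstituent l u → InConstituent l v → slot u ≡ slot v → u ≡ v
slot-injective {u = inj₁ _}       {inj₁ _}       refl refl _    = refl
slot-injective {u = inj₂ (_ , _)} {inj₂ (_ , _)} refl refl refl = refl

module SpecialGraph {q p} {F : Adjacency (Fin p)} (F-simple : IsSimple F)
  (Tr : Adjacency (Fin q)) (Tr-simple : IsSimple Tr)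
  (Fs : Fin q → Adjacency (Fin p)) (Fs≅F : ∀ l → Fs l ≅ F) (w : Fin q → Fin p) where

  G : Adjacency (SVert q p)
  G = specialAdj Tr Fs w

  _~_ : SVert q p → SVert q p → Set
  u ~ v = u ~[ G ] v

  copyAdj-diag : ∀ l a b → copyAdj Fs l a l b ≡ Fs l a b
  copyAdj-diag l a b with l ≟ l
  ... | yes refl = refl
  ... | no l≢l   = ⊥-elim (l≢l refl)

  copyAdj⇒sameCopy : ∀ {l a m b} → T (copyAdj Fs l a m b) → l ≡ m
  copyAdj⇒sameCopy {l} {m = m} t with l ≟ m
  ... | yes l≡m = l≡m
  ... | no _    = ⊥-elim t

  hub~pendant : ∀ {m l b} → inj₁ m ~ inj₂ (l , b) → m ≡ l × b ≡ w l
  hub~pendant {m} {l} {b} t with Equivalence.to T-∧ t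
  ... | t₁ , t₂ = toWitness {a? = m ≟ l} t₁ , toWitness {a? = b ≟ w l} t₂

  pendant~hub : ∀ {l b m} → inj₂ (l , b) ~ inj₁ m → l ≡ m × b ≡ w l
  pendant~hub {l} {b} {m} t with Equivalence.to T-∧ t
  ... | t₁ , t₂ = toWitness {a? = l ≟ m} t₁ , toWitness {a? = b ≟ w l} t₂

  pendant-adjacent-hub : ∀ l → inj₂ (l , w l) ~ inj₁ l
  pendant-adjacent-hub l =
    Equivalence.from T-∧ (fromWitness {a? = l ≟ l} refl , fromWitness {a? = w l ≟ w l} refl)

  hub-neighbours : ∀ {l v} → inj₁ l ~ v →
    (∃[ m ] v ≡ inj₁ m × T (Tr l m)) ⊎ v ≡ inj₂ (l , w l)
  hub-neighbours {v = inj₁ m} t = inj₁ (m , refl , t)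
  hub-neighbours {l} {inj₂ (m , b)} t with hub~pendant {l} {m} {b} t
  ... | refl , refl = inj₂ refl

  copy-neighbour-in-constituent : ∀ {l a v} → inj₂ (l , a) ~ v → InConstituent l v
  copy-neighbour-in-constituent {v = inj₁ _}       t = sym (proj₁ (pendant~hub t))
  copy-neighbour-in-constituent {v = inj₂ (_ , _)} t = sym (copyAdj⇒sameCopy t)

  tree-neighbour-distinct : ∀ {l m} → T (Tr l m) → l ≢ m
  tree-neighbour-distinct {l} l~l refl = ¬T-false (IsSimple.irreflexive Tr-simple l) l~l

  G-irreflexive : ∀ v → ¬ v ~ v
  G-irreflexive (inj₁ m) = ¬T-false (IsSimple.irreflexive Tr-simple m)
  G-irreflexive (inj₂ (l , a)) =
    ¬T-false (trans (copyAdj-diag l a a)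
                    (≅-irreflexive {adjB = F} (Fs≅F l) (IsSimple.irreflexive F-simple) a))

  constituent-neighbour : NoIsolatedVertex F → ∀ {l d} → InConstituent l d →
                          ∃[ n ] InConstituent l n × n ~ d
  constituent-neighbour _ {d = inj₁ l} refl = inj₂ (l , w l) , refl , pendant-adjacent-hub l
  constituent-neighbour F-noIso {d = inj₂ (l , a)} refl
    with ≅-noIsolatedVertex {adjB = F} (Fs≅F l) F-noIso a
  ... | s , s~a = inj₂ (l , s) , refl , subst T (sym (copyAdj-diag l s a)) s~a

  -- G_l has p + 1 vertices, and N[d] contains d and a neighbour of d inside G_l.
  no-copy-in-constituent-avoiding : NoIsolatedVertex F → ∀ {l d} (f : Fin p → SVert q p) →
    Injective _≡_ _≡_ f → (∀ a → InConstituent l (f a)) → InConstituent l d →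
    (∀ a → ¬ (f a ≡ d ⊎ f a ~ d)) → ¬ Fin p
  no-copy-in-constituent-avoiding F-noIso {l} {d} f f-inj f∈Gl d∈Gl f-avoid
    with constituent-neighbour F-noIso d∈Gl
  ... | n , n∈Gl , n~d =
    injection-missing-two⇒empty slot∘f-injective slot-d≢slot-n
      (λ a eq → f-avoid a (inj₁ (slot-injective (f∈Gl a) d∈Gl (sym eq))))
      (λ a eq → f-avoid a (inj₂ (subst (_~ d) (slot-injective n∈Gl (f∈Gl a) eq) n~d)))
    where
      slot∘f-injective : Injective _≡_ _≡_ (slot ∘ f)
      slot∘f-injective eq = f-inj (slot-injective (f∈Gl _) (f∈Gl _) eq)
      slot-d≢slot-n : slot d ≢ slot n
      slot-d≢slot-n eq = G-irreflexive d (subst (_~ d) (slot-injective n∈Gl d∈Gl (sym eq)) n~d)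

  constituent-copy : Fin q → Fin p → SVert q p
  constituent-copy l a = inj₂ (l , Inverse.from (proj₁ (Fs≅F l)) a)

  isolating⇒meets-constituent : ∀ {D} → IsIsolating F G D → ∀ l → Any (InConstituent l) D
  isolating⇒meets-constituent {D} D-isol l with any? (inConstituent? l) D
  ... | yes meets = meets
  ... | no misses = ⊥-elim (D-isol (constituent-copy l , copy-injective , copy-edge , copy-avoids))
    where
      copy-injective : Injective _≡_ _≡_ (constituent-copy l)
      copy-injective eq = ≅-from-injective {adjB = F} (Fs≅F l) (suc-injective (cong slot eq))
      copy-edge : ∀ a b → a ~[ F ] b → constituent-copy l a ~ constituent-copy l b
      copy-edge a b a~b = subst T (sym (copyAdj-diag l _ _)) (≅-from-edge {adjB = F} (Fs≅F l) a~b)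
      copy-avoids : ∀ a → ¬ InClosedNbhd G D (constituent-copy l a)
      copy-avoids a (d , d∈D , inj₁ refl)    = misses (lose d∈D refl)
      copy-avoids a (d , d∈D , inj₂ copy~d) = misses (lose d∈D (copy-neighbour-in-constituent copy~d))

  isolating⇒length≥q : ∀ {D} → IsIsolating F G D → q ≤ length D
  isolating⇒length≥q {D} D-isol = injective⇒≤ position-injective
    where
      position : Fin q → Fin (length D)
      position l = index (isolating⇒meets-constituent D-isol l)
      position-injective : Injective _≡_ _≡_ position
      position-injective {l} {l′} eq =
        constituent-unique (lookup D (position l′))
          (subst (λ i → InConstituent l (lookup D i)) eq
                 (lookup-index (isolating⇒meets-constituent D-isol l)))
          (lookup-index (isolating⇒meets-constituent D-isol l′))

  -- Away from c, the copy can only use the hub v_j and the pendant vertex w_l.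
  no-copy-centred-at-hub : ∀ {D c l j} (f : Fin p → SVert q p) → Injective _≡_ _≡_ f →
    (∀ a b → a ~[ F ] b → f a ~ f b) → (∀ a → ¬ InClosedNbhd G D (f a)) →
    (∀ u → u ≢ c → c ~[ F ] u) → OutgrowsIndependentPair F c →
    f c ≡ inj₁ l → l ≢ j → (∀ m → T (Tr l m) → m ≢ j → inj₁ m ∈ D) → ⊥
  no-copy-centred-at-hub {D} {c} {l} {j} f f-inj f-edge f-avoid c-dom out fc l≢j hubs∈D =
    no-copy-into-independent-pair {G = G} out f f-inj f-edge (inj₁ j) (inj₂ (l , w l))
      (l≢j ∘ sym ∘ proj₁ ∘ hub~pendant) (l≢j ∘ proj₁ ∘ pendant~hub) into
    where
      into : ∀ u → u ≢ c → f u ≡ inj₁ j ⊎ f u ≡ inj₂ (l , w l)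
      into u u≢c with hub-neighbours (subst (_~ f u) fc (f-edge c u (c-dom u u≢c)))
      ... | inj₂ fu≡pendant = inj₂ fu≡pendant
      ... | inj₁ (m , fu≡hub , l~m) with m ≟ j
      ...   | yes refl = inj₁ fu≡hub
      ...   | no m≢j   = ⊥-elim (f-avoid u (inj₁ m , hubs∈D m l~m m≢j , inj₁ fu≡hub))

  module Representatives {i j} (i≢j : i ≢ j) {x y : SVert q p}
                         (x∈Gi : InConstituent i x) (y∈Gj : InConstituent j y) where

    rep : Fin q → SVert q p
    rep l with l ≟ i | l ≟ j
    ... | yes _ | _     = x
    ... | no _  | yes _ = y
    ... | no _  | no _  = inj₁ l

    rep-in-constituent : ∀ l → InConstituent l (rep l)
    rep-in-constituent l with l ≟ i | l ≟ j
    ... | yes refl | _        = x∈Gi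
    ... | no _     | yes refl = y∈Gj
    ... | no _     | no _     = refl

    rep-hub : ∀ {l} → l ≢ i → l ≢ j → rep l ≡ inj₁ l
    rep-hub {l} l≢i l≢j with l ≟ i | l ≟ j
    ... | yes l≡i | _       = ⊥-elim (l≢i l≡i)
    ... | no _    | yes l≡j = ⊥-elim (l≢j l≡j)
    ... | no _    | no _    = refl

    rep-i : rep i ≡ x
    rep-i with i ≟ i
    ... | yes _   = refl
    ... | no i≢i  = ⊥-elim (i≢i refl)

    rep-j : rep j ≡ y
    rep-j with j ≟ i | j ≟ j
    ... | yes j≡i | _       = ⊥-elim (i≢j (sym j≡i))
    ... | no _    | yes _   = refl
    ... | no _    | no j≢j  = ⊥-elim (j≢j refl)

    D : List (SVert q p)
    D = map rep (allFin q)

    rep∈D : ∀ l → rep l ∈ D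
    rep∈D l = ∈-map⁺ rep (∈-allFin l)

    x∈D : x ∈ D
    x∈D = subst (_∈ D) rep-i (rep∈D i)

    y∈D : y ∈ D
    y∈D = subst (_∈ D) rep-j (rep∈D j)

    hub∈D : ∀ {l} → l ≢ i → l ≢ j → inj₁ l ∈ D
    hub∈D l≢i l≢j = subst (_∈ D) (rep-hub l≢i l≢j) (rep∈D _)

    D-unique : Unique D
    D-unique = map⁺ rep-injective (allFin⁺ q)
      where
        rep-injective : Injective _≡_ _≡_ rep
        rep-injective {l} {l′} eq =
          constituent-unique (rep l′) (subst (InConstituent l) eq (rep-in-constituent l))
                             (rep-in-constituent l′)

    D-length : length D ≡ q
    D-length = trans (length-map rep (allFin q)) (length-tabulate (λ l → l))

    D-minimum : ∀ D′ → IsIsolating F G D′ → length D ≤ length D′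
    D-minimum D′ D′-isol = subst (_≤ length D′) (sym D-length) (isolating⇒length≥q D′-isol)

    D-isolating : 3 ≤ edgeCount F → HasDominatingVertex F → IsIsolating F G D
    D-isolating 3≤e (c , c-dom) (f , f-inj , f-edge , f-avoid) with f c in fc
    ... | inj₂ (l , a) =
      no-copy-in-constituent-avoiding F-noIso f f-inj f∈Gl (rep-in-constituent l)
        (λ u near → f-avoid u (rep l , rep∈D l , near)) c
      where
        F-noIso : NoIsolatedVertex F
        F-noIso = dominating⇒noIsolatedVertex F-simple c-dom
                    (proj₂ (outgrows⇒other (outgrowsIndependentPair F 3≤e c)))
        f∈Gl : ∀ u → InConstituent l (f u)
        f∈Gl u with u ≟ c
        ... | yes refl = subst (InConstituent l) (sym fc) refl
        ... | no u≢c   = copy-neighbour-in-constituent (subst (_~ f u) fc (f-edge c u (c-dom u u≢c)))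
    ... | inj₁ l with l ≟ i | l ≟ j
    ...   | yes refl | _ =
      no-copy-centred-at-hub f f-inj f-edge f-avoid c-dom (outgrowsIndependentPair F 3≤e c)
        fc i≢j (λ m i~m m≢j → hub∈D (tree-neighbour-distinct i~m ∘ sym) m≢j)
    ...   | no _ | yes refl =
      no-copy-centred-at-hub f f-inj f-edge f-avoid c-dom (outgrowsIndependentPair F 3≤e c)
        fc (i≢j ∘ sym) (λ m j~m m≢i → hub∈D m≢i (tree-neighbour-distinct j~m ∘ sym))
    ...   | no l≢i | no l≢j = f-avoid c (inj₁ l , hub∈D l≢i l≢j , inj₁ fc)

lemma3p5 : (k p m q : ℕ) (F : Adjacency (Fin p)) →
    3 ≤ k → IsSimple F → edgeCount F ≡ k → HasDominatingVertex F →
    1 ≤ q → m + 1 ≡ q * (k + 2) →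
    (T : Adjacency (Fin q)) → IsTree T →
    (Fs : Fin q → Adjacency (Fin p)) → (∀ i → Fs i ≅ F) →
    (w : Fin q → Fin p) →
    (i j : Fin q) → i ≢ j →
    (x y : SVert q p) → InConstituent i x → InConstituent j y →
    Σ (List (SVert q p)) λ D →
      IsMinIsolating F (specialAdj T Fs w) D × x ∈ D × y ∈ D
lemma3p5 k p m q F 3≤k F-simple refl F-dom _ _ Tr (Tr-simple , _) Fs Fs≅F w i j i≢j x y x∈Gi y∈Gj =
  D , (D-unique , D-isolating 3≤k F-dom , λ D′ _ → D-minimum D′) , x∈D , y∈D
  where
    open SpecialGraph F-simple Tr Tr-simple Fs Fs≅F w
    open Representatives i≢j x∈Gi y∈Gj
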